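{- For every type $A$, $A \approx \mathrm{minS}(A)$.
   Context: Types are given by the grammar: atomic types $\mathbb{A} ::= \mathbb{B} \mid \mathbb{X}$; base types $M ::= \mathbb{A} \mid M \times M$; qubit types $\Psi ::= M \mid S(\Psi) \mid \Psi \times \Psi$; types $A ::= \Psi \mid \Psi \Rightarrow A \mid S(A)$, products taken modulo associativity. The subtyping relation $\preceq$ is the least relation closed under: $A \preceq A$; transitivity; $A \preceq S(A)$; $S(S(A)) \preceq S(A)$; for atomic types $\mathbb{A}_i,\mathbb{A}'_i$, $\prod_{i=0}^n \mathbb{A}_i \preceq S(\prod_{i=0}^n \mathbb{A}'_i)$; if $A \preceq B$ then $S(A) \preceq S(B)$; if $A \preceq B$ and $\Psi_1 \preceq \Psi_2$ then $\Psi_2 \Rightarrow A \preceq \Psi_1 \Rightarrow B$; if $\Psi_1 \preceq \Psi_2$ and $\Psi_3 \preceq \Psi_4$ then $\Psi_1 \times \Psi_3 \preceq \Psi_2 \times \Psi_4$. $A \approx B$ means $A \preceq B$ and $B \preceq A$. The function $\mathrm{minS}$ (collapsing nested $S$) is defined recursively (up to $\approx$) by: $\mathrm{minS}(M) \approx M$ for base types $M$; $\mathrm{minS}(\Psi \Rightarrow A) \approx \mathrm{minS}(\Psi) \Rightarrow \mathrm{minS}(A)$; $\mathrm{minS}(\Psi_1 \times \Psi_2) \approx \mathrm{minS}(\Psi_1) \times \mathrm{minS}(\Psi_2)$; if $A \approx S(B)$ for some $B$ then $\mathrm{minS}(S(A)) \approx \mathrm{minS}(A)$; otherwise $\mathrm{minS}(S(A))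 \approx S(\mathrm{minS}(A))$. -}

module Defs where

open import Data.Product using (Σ; _×_)
open import Relation.Nullary using (¬_)

-- Raw syntax of types.  Well-formedness (the grammar of the paper) is
-- given by the predicates IsAtomic / IsBase / IsQubit / IsType below.
infixr 7 _⊗_
infixr 5 _⇒_
data Ty : Set where
  𝔹 𝕏 : Ty
  _⊗_ : Ty → Ty → Ty
  S   : Ty → Ty
  _⇒_ : Ty → Ty → Ty

data IsAtomic : Ty → Set where
  atB : IsAtomic 𝔹
  atX : IsAtomic 𝕏

data IsBase : Ty → Set where
  base-at : ∀ {a} → IsAtomic a → IsBase a
  base-× : ∀ {m n} → IsBase m → IsBase n → IsBase (m ⊗ n)

data IsQubit : Ty → Set where
  q-base : ∀ {m} → IsBase m → IsQubit m
  q-S    : ∀ {ψ} → IsQubit ψ → IsQubit (S ψ)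
  q-×    : ∀ {ψ φ} → IsQubit ψ → IsQubit φ → IsQubit (ψ ⊗ φ)

data IsType : Ty → Set where
  t-q : ∀ {ψ} → IsQubit ψ → IsType ψ
  t-⇒ : ∀ {ψ a} → IsQubit ψ → IsType a → IsType (ψ ⇒ a)
  t-S : ∀ {a} → IsType a → IsType (S a)

infix 4 _≡ₐ_
data _≡ₐ_ : Ty → Ty → Set where
  ≡ₐ-refl  : ∀ {a} → a ≡ₐ a
  ≡ₐ-sym   : ∀ {a b} → a ≡ₐ b → b ≡ₐ a
  ≡ₐ-trans : ∀ {a b c} → a ≡ₐ b → b ≡ₐ c → a ≡ₐ c
  ≡ₐ-assoc : ∀ {a b c} → (a ⊗ b) ⊗ c ≡ₐ a ⊗ (b ⊗ c)
  ≡ₐ-⊗     : ∀ {a a' b b'} → a ≡ₐ a' → b ≡ₐ b' → a ⊗ b ≡ₐ a' ⊗ b'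
  ≡ₐ-S     : ∀ {a a'} → a ≡ₐ a' → S a ≡ₐ S a'
  ≡ₐ-⇒     : ∀ {a a' b b'} → a ≡ₐ a' → b ≡ₐ b' → (a ⇒ b) ≡ₐ (a' ⇒ b')

-- Two products of atomic types with the same number of factors,
-- ∏_{i=0}^n 𝔸_i and ∏_{i=0}^n 𝔸'_i (bracketed the same way; other
-- bracketings are reached through associativity).
data AtomProds : Ty → Ty → Set where
  ap-at : ∀ {a a'} → IsAtomic a → IsAtomic a' → AtomProds a a'
  ap-×  : ∀ {a a' b b'} → AtomProds a a' → AtomProds b b' → AtomProds (a ⊗ b) (a' ⊗ b')

infix 4 _≼_ _≈_
data _≼_ : Ty → Ty → Set where
  ≼-refl  : ∀ {a} → IsType a → a ≼ a
  ≼-assoc : ∀ {a b} → IsType a → IsType b → a ≡ₐ b → a ≼ b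
  ≼-trans : ∀ {a b c} → a ≼ b → b ≼ c → a ≼ c
  ≼-S     : ∀ {a} → IsType a → a ≼ S a
  ≼-SS    : ∀ {a} → IsType a → S (S a) ≼ S a
  ≼-atoms : ∀ {p p'} → AtomProds p p' → p ≼ S p'
  ≼-congS : ∀ {a b} → a ≼ b → S a ≼ S b
  ≼-⇒     : ∀ {a b ψ₁ ψ₂} → IsQubit ψ₁ → IsQubit ψ₂ →
            a ≼ b → ψ₁ ≼ ψ₂ → (ψ₂ ⇒ a) ≼ (ψ₁ ⇒ b)
  ≼-×     : ∀ {ψ₁ ψ₂ ψ₃ ψ₄} → IsQubit ψ₁ → IsQubit ψ₂ → IsQubit ψ₃ → IsQubit ψ₄ →
            ψ₁ ≼ ψ₂ → ψ₃ ≼ ψ₄ → ψ₁ ⊗ ψ₃ ≼ ψ₂ ⊗ ψ₄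

_≈_ : Ty → Ty → Set
a ≈ b = (a ≼ b) × (b ≼ a)

-- minS, defined recursively up to ≈ : MinS a b means "b is (a choice of) minS(a)".
data MinS : Ty → Ty → Set where
  minS-base  : ∀ {m b} → IsBase m → b ≈ m → MinS m b
  minS-⇒     : ∀ {ψ a p q b} → IsQubit ψ → IsType a →
               MinS ψ p → MinS a q → b ≈ (p ⇒ q) → MinS (ψ ⇒ a) b
  minS-×     : ∀ {ψ₁ ψ₂ p q b} → IsQubit ψ₁ → IsQubit ψ₂ →
               MinS ψ₁ p → MinS ψ₂ q → b ≈ (p ⊗ q) → MinS (ψ₁ ⊗ ψ₂) b
  minS-SS    : ∀ {a c p b} → IsType a → IsType c → a ≈ S c →
               MinS a p → b ≈ p → MinS (S a) b
  minS-S     : ∀ {a p b} → IsType a → ¬ (Σ Ty λ c → IsType c × (a ≈ S c)) →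
               MinS a p → b ≈ S p → MinS (S a) b
  minS-assoc : ∀ {a a' b} → a ≡ₐ a' → MinS a b → MinS a' b

{-# OPTIONS --safe #-}
-- Induction on the derivation of MinS a b: each clause of minS is matched by
-- a congruence of ≈ for ⇒, ⊗ or S, except the collapsing one, where a ≈ S c
-- lets S a absorb its outer S through S (S c) ≼ S c.  The qubit side
-- conditions of the congruences hold because ≼ only relates well-formed
-- types, and well-formedness is invariant under reassociation of products.
module Submission where

open import Defs
open import Data.Empty using (⊥-elim)
open import Data.Product using (_×_; _,_; proj₁; proj₂; swap)
open import Data.Product.Algebra using (×-assoc)
open import Data.Product.Function.NonDependent.Propositional using (_×-⇔_)
open import Function.Base using (_∘_)
open import Function.Bundles using (_⇔_; mk⇔; Equivalence)
import Function.Properties.Equivalence as ⇔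
open import Function.Related.Propositional using (module EquationalReasoning)
open import Relation.Nullary using (¬_)

private
  variable
    a b c ψ φ ψ₁ ψ₂ φ₁ φ₂ : Ty

open Equivalence using (to; from)

¬IsQubit-⇒ : ¬ IsQubit (a ⇒ b)
¬IsQubit-⇒ (q-base (base-at ()))

IsQubit-⊗ : IsQubit (a ⊗ b) ⇔ (IsQubit a × IsQubit b)
IsQubit-⊗ = mk⇔ components λ (qa , qb) → q-× qa qb
  where
  components : IsQubit (a ⊗ b) → IsQubit a × IsQubit b
  components (q-base (base-× ma mb)) = q-base ma , q-base mb
  components (q-× qa qb)             = qa , qb

IsQubit-S : IsQubit (S a) ⇔ IsQubit a
IsQubit-S = mk⇔ body q-S
  where
  body : IsQubit (S a) → IsQubit a
  body (q-base (base-at ()))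
  body (q-S qa) = qa

IsType-⊗ : IsType (a ⊗ b) ⇔ IsQubit (a ⊗ b)
IsType-⊗ = mk⇔ (λ { (t-q q) → q }) t-q

IsType-S : IsType (S a) ⇔ IsType a
IsType-S = mk⇔ body t-S
  where
  body : IsType (S a) → IsType a
  body (t-q q) = t-q (to IsQubit-S q)
  body (t-S t) = t

IsType-⇒ : IsType (a ⇒ b) ⇔ (IsQubit a × IsType b)
IsType-⇒ = mk⇔ components λ (qa , tb) → t-⇒ qa tb
  where
  components : IsType (a ⇒ b) → IsQubit a × IsType b
  components (t-q q)     = ⊥-elim (¬IsQubit-⇒ q)
  components (t-⇒ qa tb) = qa , tb

≡ₐ⇒IsQubit⇔ : a ≡ₐ b → IsQubit a ⇔ IsQubit b
≡ₐ⇒IsQubit⇔ ≡ₐ-refl         = ⇔.refl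
≡ₐ⇒IsQubit⇔ (≡ₐ-sym e)      = ⇔.sym (≡ₐ⇒IsQubit⇔ e)
≡ₐ⇒IsQubit⇔ (≡ₐ-trans e f)  = ⇔.trans (≡ₐ⇒IsQubit⇔ e) (≡ₐ⇒IsQubit⇔ f)
≡ₐ⇒IsQubit⇔ (≡ₐ-assoc {a} {b} {c}) = begin
  IsQubit ((a ⊗ b) ⊗ c)                   ∼⟨ IsQubit-⊗ ⟩
  (IsQubit (a ⊗ b) × IsQubit c)           ∼⟨ IsQubit-⊗ ×-⇔ ⇔.refl ⟩
  ((IsQubit a × IsQubit b) × IsQubit c)   ↔⟨ ×-assoc _ _ _ _ ⟩
  (IsQubit a × (IsQubit b × IsQubit c))   ∼⟨ ⇔.sym (⇔.refl ×-⇔ IsQubit-⊗) ⟩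
  (IsQubit a × IsQubit (b ⊗ c))           ∼⟨ ⇔.sym IsQubit-⊗ ⟩
  IsQubit (a ⊗ (b ⊗ c))                   ∎
  where open EquationalReasoning
≡ₐ⇒IsQubit⇔ (≡ₐ-⊗ e f) =
  ⇔.trans IsQubit-⊗ (⇔.trans (≡ₐ⇒IsQubit⇔ e ×-⇔ ≡ₐ⇒IsQubit⇔ f) (⇔.sym IsQubit-⊗))
≡ₐ⇒IsQubit⇔ (≡ₐ-S e) = ⇔.trans IsQubit-S (⇔.trans (≡ₐ⇒IsQubit⇔ e) (⇔.sym IsQubit-S))
≡ₐ⇒IsQubit⇔ (≡ₐ-⇒ _ _) = mk⇔ (⊥-elim ∘ ¬IsQubit-⇒) (⊥-elim ∘ ¬IsQubit-⇒)

≡ₐ⇒IsType⇔ : a ≡ₐ b → IsType a ⇔ IsType b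
≡ₐ⇒IsType⇔ ≡ₐ-refl        = ⇔.refl
≡ₐ⇒IsType⇔ (≡ₐ-sym e)     = ⇔.sym (≡ₐ⇒IsType⇔ e)
≡ₐ⇒IsType⇔ (≡ₐ-trans e f) = ⇔.trans (≡ₐ⇒IsType⇔ e) (≡ₐ⇒IsType⇔ f)
≡ₐ⇒IsType⇔ e@≡ₐ-assoc     = ⇔.trans IsType-⊗ (⇔.trans (≡ₐ⇒IsQubit⇔ e) (⇔.sym IsType-⊗))
≡ₐ⇒IsType⇔ e@(≡ₐ-⊗ _ _)   = ⇔.trans IsType-⊗ (⇔.trans (≡ₐ⇒IsQubit⇔ e) (⇔.sym IsType-⊗))
≡ₐ⇒IsType⇔ (≡ₐ-S e)       = ⇔.trans IsType-S (⇔.trans (≡ₐ⇒IsType⇔ e) (⇔.sym IsType-S))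
≡ₐ⇒IsType⇔ (≡ₐ-⇒ e f)     =
  ⇔.trans IsType-⇒ (⇔.trans (≡ₐ⇒IsQubit⇔ e ×-⇔ ≡ₐ⇒IsType⇔ f) (⇔.sym IsType-⇒))

AtomProds⇒IsBase : AtomProds a b → IsBase a × IsBase b
AtomProds⇒IsBase (ap-at aa ab) = base-at aa , base-at ab
AtomProds⇒IsBase (ap-× p q) with AtomProds⇒IsBase p | AtomProds⇒IsBase q
... | ma , mb | mc , md = base-× ma mc , base-× mb md

≼⇒IsType : a ≼ b → IsType a × IsType b
≼⇒IsType (≼-refl t)        = t , t
≼⇒IsType (≼-assoc ta tb _) = ta , tb
≼⇒IsType (≼-trans p q)     = proj₁ (≼⇒IsType p) , proj₂ (≼⇒IsType q)
≼⇒IsType (≼-S t)           = t , t-S t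
≼⇒IsType (≼-SS t)          = t-S (t-S t) , t-S t
≼⇒IsType (≼-atoms p) with AtomProds⇒IsBase p
... | ma , mb = t-q (q-base ma) , t-q (q-S (q-base mb))
≼⇒IsType (≼-congS p) with ≼⇒IsType p
... | ta , tb = t-S ta , t-S tb
≼⇒IsType (≼-⇒ q₁ q₂ p _) with ≼⇒IsType p
... | ta , tb = t-⇒ q₂ ta , t-⇒ q₁ tb
≼⇒IsType (≼-× q₁ q₂ q₃ q₄ _ _) = t-q (q-× q₁ q₃) , t-q (q-× q₂ q₄)

≈⇒IsTypeʳ : a ≈ b → IsType b
≈⇒IsTypeʳ (a≼b , _) = proj₂ (≼⇒IsType a≼b)

≈-sym : a ≈ b → b ≈ a
≈-sym = swap

≈-trans : a ≈ b → b ≈ c → a ≈ c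
≈-trans (a≼b , b≼a) (b≼c , c≼b) = ≼-trans a≼b b≼c , ≼-trans c≼b b≼a

≡ₐ⇒≈ : IsType a → a ≡ₐ b → a ≈ b
≡ₐ⇒≈ {a} {b} ta e = ≼-assoc ta tb e , ≼-assoc tb ta (≡ₐ-sym e)
  where
  tb : IsType b
  tb = to (≡ₐ⇒IsType⇔ e) ta

≈-S : a ≈ b → S a ≈ S b
≈-S (a≼b , b≼a) = ≼-congS a≼b , ≼-congS b≼a

≈-⇒ : IsQubit ψ → IsQubit φ → ψ ≈ φ → a ≈ b → (ψ ⇒ a) ≈ (φ ⇒ b)
≈-⇒ qψ qφ (ψ≼φ , φ≼ψ) (a≼b , b≼a) = ≼-⇒ qφ qψ a≼b φ≼ψ , ≼-⇒ qψ qφ b≼a ψ≼φ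

≈-⊗ : IsQubit ψ₁ → IsQubit ψ₂ → IsQubit φ₁ → IsQubit φ₂ →
      ψ₁ ≈ φ₁ → ψ₂ ≈ φ₂ → ψ₁ ⊗ ψ₂ ≈ φ₁ ⊗ φ₂
≈-⊗ q₁ q₂ r₁ r₂ (ψ₁≼φ₁ , φ₁≼ψ₁) (ψ₂≼φ₂ , φ₂≼ψ₂) =
  ≼-× q₁ r₁ q₂ r₂ ψ₁≼φ₁ ψ₂≼φ₂ , ≼-× r₁ q₁ r₂ q₂ φ₁≼ψ₁ φ₂≼ψ₂

S-idem : a ≈ S c → S a ≈ a
S-idem {a} {c} (a≼Sc , Sc≼a) = ≼-trans (≼-congS a≼Sc) (≼-trans (≼-SS tc) Sc≼a) , ≼-S ta
  where
  ta : IsType a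
  ta = proj₁ (≼⇒IsType a≼Sc)
  tc : IsType c
  tc = to IsType-S (proj₂ (≼⇒IsType a≼Sc))

lemma11 : ∀ (a b : Ty) → IsType a → MinS a b → a ≈ b
lemma11 _ _ _ (minS-base _ b≈m) = ≈-sym b≈m
lemma11 _ _ _ (minS-⇒ {p = p} qψ ta ψ↦p a↦q b≈p⇒q) =
  ≈-trans (≈-⇒ qψ qp (lemma11 _ _ (t-q qψ) ψ↦p) (lemma11 _ _ ta a↦q)) (≈-sym b≈p⇒q)
  where
  qp : IsQubit p
  qp = proj₁ (to IsType-⇒ (≈⇒IsTypeʳ b≈p⇒q))
lemma11 _ _ _ (minS-× q₁ q₂ ψ₁↦p ψ₂↦q b≈p⊗q)
  with to IsQubit-⊗ (to IsType-⊗ (≈⇒IsTypeʳ b≈p⊗q))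
... | qp , qq =
  ≈-trans (≈-⊗ q₁ q₂ qp qq (lemma11 _ _ (t-q q₁) ψ₁↦p) (lemma11 _ _ (t-q q₂) ψ₂↦q))
          (≈-sym b≈p⊗q)
lemma11 _ _ _ (minS-SS ta _ a≈Sc a↦p b≈p) =
  ≈-trans (S-idem a≈Sc) (≈-trans (lemma11 _ _ ta a↦p) (≈-sym b≈p))
lemma11 _ _ _ (minS-S ta _ a↦p b≈Sp) = ≈-trans (≈-S (lemma11 _ _ ta a↦p)) (≈-sym b≈Sp)
lemma11 _ _ ta′ (minS-assoc {a} a≡ₐa′ a↦b) =
  ≈-trans (≈-sym (≡ₐ⇒≈ ta a≡ₐa′)) (lemma11 _ _ ta a↦b)
  where
  ta : IsType a
  ta = from (≡ₐ⇒IsType⇔ a≡ₐa′) ta′
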